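{- Let $d,\ell\ge 2$ be integers. The cyclic Kautz digraph $CK(d,\ell)$ is the line digraph of the subKautz digraph $sK(d,\ell-1)$, that is, $CK(d,\ell)\cong L(sK(d,\ell-1))$.
   Context: All words are over the alphabet $\mathbb{Z}_{d+1}=\{0,1,\dots,d\}$. The subKautz digraph $sK(d,m)$ has vertex set $\{x_1x_2\ldots x_m : x_i\neq x_{i+1},\ i=1,\dots,m-1\}$ and arcs $x_1x_2\ldots x_m\to x_2\ldots x_m x_{m+1}$ for every $x_{m+1}\neq x_1,x_m$. The cyclic Kautz digraph $CK(d,\ell)$ has vertex set $\{x_1\ldots x_\ell : x_i\neq x_{i+1},\ i=1,\dots,\ell-1,\ \text{and } x_\ell\neq x_1\}$ and arcs $x_1x_2\ldots x_\ell\to x_2\ldots x_\ell y$ for every $y\neq x_2,x_\ell$. The line digraph $L(G)$ of a digraph $G$ has as vertices the arcs $(u,v)$ of $G$, with $(u,v)$ adjacent to $(w,z)$ iff $v=w$. -}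

module Defs where

open import Data.Nat using (ℕ; zero; suc)
open import Data.Fin using (Fin; _≟_)
open import Data.Vec using (Vec; []; _∷_; head; last; tail; _∷ʳ_)
open import Data.Product using (Σ; ∃; _×_; _,_; proj₁)
open import Data.Unit using (⊤)
open import Data.Empty using (⊥)
open import Relation.Nullary.Decidable using (False)
open import Relation.Binary.PropositionalEquality using (_≡_)
open import Function.Bundles using (_⤖_; _⇔_; Bijection)

record Digraph : Set₁ where
  field
    V   : Set
    Arc : V → V → Set
open Digraph public

Sym : ℕ → Set
Sym d = Fin (suc d)

-- x ≠ y, as a proof-irrelevant (unit-or-empty) type
_≉_ : ∀ {d} → Sym d → Sym d → Set
x ≉ y = False (x ≟ y)

NoRep : ∀ {d n} → Vec (Sym d) n → Set
NoRep []           = ⊤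
NoRep (x ∷ [])     = ⊤
NoRep (x ∷ y ∷ xs) = x ≉ y × NoRep (y ∷ xs)

Word : ℕ → ℕ → Set
Word d m = Σ (Vec (Sym d) m) NoRep

-- subKautz digraph sK(d,m):
-- x_1…x_m → x_2…x_m x_{m+1} for every x_{m+1} ≠ x_1, x_m.
-- (For m = 0 there is no x_1 / x_m; we give it no arcs. It is never used
--  in the theorem since m = ℓ - 1 ≥ 1.)
sKArc : ∀ d m → Word d m → Word d m → Set
sKArc d zero    u v = ⊥
sKArc d (suc n) (x , _) (y , _) =
  Σ (Sym d) λ z → z ≉ head x × z ≉ last x × y ≡ tail x ∷ʳ z

sK : ℕ → ℕ → Digraph
sK d m = record { V = Word d m ; Arc = sKArc d m }

CKVert : ℕ → ℕ → Set
CKVert d zero    = Word d zero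
CKVert d (suc n) = Σ (Word d (suc n)) λ w → last (proj₁ w) ≉ head (proj₁ w)

CKArc : ∀ d ℓ → CKVert d ℓ → CKVert d ℓ → Set
CKArc d zero          u v = ⊥
CKArc d (suc zero)    u v = ⊥   -- ℓ = 1 has no x_2; never used (ℓ ≥ 2)
CKArc d (suc (suc n)) ((x , _) , _) ((y , _) , _) =
  Σ (Sym d) λ z → z ≉ head (tail x) × z ≉ last x × y ≡ tail x ∷ʳ z

CK : ℕ → ℕ → Digraph
CK d ℓ = record { V = CKVert d ℓ ; Arc = CKArc d ℓ }

L : Digraph → Digraph
L G = record
  { V   = Σ (V G) λ u → Σ (V G) λ v → Arc G u v
  ; Arc = λ { (u , v , _) (w , z , _) → v ≡ w } }

record _≅_ (G H : Digraph) : Set where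
  field
    bij     : V G ⤖ V H
    arc-iff : ∀ u v → Arc G u v ⇔ Arc H (Bijection.to bij u) (Bijection.to bij v)

-- A vertex x₁…x_ℓ of CK(d,ℓ) is the same thing as the arc x₁…x_{ℓ-1} → x₂…x_ℓ of
-- sK(d,ℓ-1): the arc condition x_ℓ ≠ x_{ℓ-1} is part of "no two equal consecutive
-- letters", and x_ℓ ≠ x₁ is the cyclic condition. Under this correspondence both
-- kinds of adjacency say that x₂…x_ℓ = y₁…y_{ℓ-1}.
module Submission where

open import Defs
open import Data.Nat using (ℕ; zero; suc; _≤_; _∸_; s≤s)
open import Data.Fin using (_≟_)
open import Data.Vec using (Vec; []; _∷_; head; tail; init; last; _∷ʳ_; initLast)
open import Data.Vec.Properties using (init-∷ʳ; last-∷ʳ)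
open import Data.Product using (_,_; proj₁; proj₂)
open import Data.Unit using (tt)
open import Data.Empty using (⊥-elim)
open import Relation.Nullary using (yes; no)
open import Relation.Nullary.Decidable using (toWitnessFalse; fromWitnessFalse)
open import Relation.Binary.PropositionalEquality
open import Function.Bundles using (_⇔_; mk⇔; mk↔ₛ′)
open import Function.Properties.Inverse using (↔⇒⤖)
import Function.Properties.Equivalence as ⇔

module _ {a} {A : Set a} where

  head-init : ∀ {n} (xs : Vec A (suc (suc n))) → head (init xs) ≡ head xs
  head-init (x ∷ y ∷ xs) = refl

  last-tail : ∀ {n} (xs : Vec A (suc (suc n))) → last (tail xs) ≡ last xs
  last-tail (x ∷ y ∷ xs) = refl

  head-∷ʳ : ∀ {n} z (xs : Vec A (suc n)) → head (xs ∷ʳ z) ≡ head xs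
  head-∷ʳ z (x ∷ xs) = refl

  tail-∷ʳ : ∀ {n} z (xs : Vec A (suc n)) → tail (xs ∷ʳ z) ≡ tail xs ∷ʳ z
  tail-∷ʳ z (x ∷ xs) = refl

  init-∷ʳ-last : ∀ {n} (xs : Vec A (suc n)) → init xs ∷ʳ last xs ≡ xs
  init-∷ʳ-last xs = sym (proj₂ (proj₂ (initLast xs)))

  tail-init-∷ʳ-last : ∀ {n} (xs : Vec A (suc (suc n))) → tail (init xs) ∷ʳ last xs ≡ tail xs
  tail-init-∷ʳ-last (x ∷ xs) = init-∷ʳ-last xs

module _ {d : ℕ} where

  ≉-sym : {x y : Sym d} → x ≉ y → y ≉ x
  ≉-sym x≉y = fromWitnessFalse (λ y≡x → toWitnessFalse x≉y (sym y≡x))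

  ≉-irrelevant : {x y : Sym d} (p q : x ≉ y) → p ≡ q
  ≉-irrelevant {x} {y} p q with x ≟ y
  ... | yes _ = ⊥-elim p
  ... | no  _ = refl

  NoRep-irrelevant : ∀ {n} (xs : Vec (Sym d) n) (p q : NoRep xs) → p ≡ q
  NoRep-irrelevant []           tt      tt      = refl
  NoRep-irrelevant (x ∷ [])     tt      tt      = refl
  NoRep-irrelevant (x ∷ y ∷ xs) (p , r) (q , s) =
    cong₂ _,_ (≉-irrelevant p q) (NoRep-irrelevant (y ∷ xs) r s)

  Word-≡ : ∀ {n} {u v : Word d n} → proj₁ u ≡ proj₁ v → u ≡ v
  Word-≡ {u = xs , p} {.xs , q} refl = cong (xs ,_) (NoRep-irrelevant xs p q)

  NoRep-init : ∀ {n} (xs : Vec (Sym d) (suc (suc n))) → NoRep xs → NoRep (init xs)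
  NoRep-init {zero}  (x ∷ y ∷ [])     _       = tt
  NoRep-init {suc n} (x ∷ y ∷ z ∷ xs) (p , q) = p , NoRep-init (y ∷ z ∷ xs) q

  NoRep-tail : ∀ {n} (xs : Vec (Sym d) (suc n)) → NoRep xs → NoRep (tail xs)
  NoRep-tail (x ∷ [])     _       = tt
  NoRep-tail (x ∷ y ∷ xs) (_ , q) = q

  last-init-≉-last : ∀ {n} (xs : Vec (Sym d) (suc (suc n))) → NoRep xs → last (init xs) ≉ last xs
  last-init-≉-last {zero}  (x ∷ y ∷ [])     (p , _) = p
  last-init-≉-last {suc n} (x ∷ y ∷ z ∷ xs) (_ , q) = last-init-≉-last (y ∷ z ∷ xs) q

  NoRep-∷ʳ : ∀ {n} (xs : Vec (Sym d) (suc n)) → NoRep xs → ∀ z → last xs ≉ z → NoRep (xs ∷ʳ z)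
  NoRep-∷ʳ (x ∷ [])     _       z p = p , tt
  NoRep-∷ʳ (x ∷ y ∷ xs) (p , q) z r = p , NoRep-∷ʳ (y ∷ xs) q z r

module CK≅LsK (d n : ℕ) where

  CKV : Set
  CKV = CKVert d (suc (suc n))

  sKArcs : Set
  sKArcs = V (L (sK d (suc n)))

  word : CKV → Vec (Sym d) (suc (suc n))
  word ((xs , _) , _) = xs

  source : sKArcs → Vec (Sym d) (suc n)
  source ((u , _) , _) = u

  label : sKArcs → Sym d
  label (_ , _ , (z , _)) = z

  CKV-≡ : {p q : CKV} → word p ≡ word q → p ≡ q
  CKV-≡ {(xs , r) , c} {(.xs , r′) , c′} refl rewrite NoRep-irrelevant xs r r′ =
    cong ((xs , r′) ,_) (≉-irrelevant c c′)

  -- The target of an sK-arc is determined by its source and label.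
  sKArcs-≡ : {p q : sKArcs} → source p ≡ source q → label p ≡ label q → p ≡ q
  sKArcs-≡ {(u , r) , (._ , s) , (z , a , b , refl)} {(.u , r′) , (._ , s′) , (.z , a′ , b′ , refl)} refl refl
    rewrite NoRep-irrelevant u r r′ | NoRep-irrelevant (tail u ∷ʳ z) s s′
          | ≉-irrelevant a a′ | ≉-irrelevant b b′ = refl

  toArc : CKV → sKArcs
  toArc ((xs , r) , c) =
    (init xs , NoRep-init xs r) , (tail xs , NoRep-tail xs r) ,
    (last xs , subst (last xs ≉_) (sym (head-init xs)) c , ≉-sym (last-init-≉-last xs r) ,
     sym (tail-init-∷ʳ-last xs))

  fromArc : sKArcs → CKV
  fromArc ((u , r) , _ , (z , z≉head , z≉last , _)) =
    (u ∷ʳ z , NoRep-∷ʳ u r z (≉-sym z≉last)) ,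
    subst₂ _≉_ (sym (last-∷ʳ z u)) (sym (head-∷ʳ z u)) z≉head

  toArc-fromArc : ∀ p → toArc (fromArc p) ≡ p
  toArc-fromArc ((u , _) , _ , (z , _)) = sKArcs-≡ (init-∷ʳ z u) (last-∷ʳ z u)

  fromArc-toArc : ∀ p → fromArc (toArc p) ≡ p
  fromArc-toArc ((xs , _) , _) = CKV-≡ (init-∷ʳ-last xs)

  CKArc⇔overlap : ∀ p q → CKArc d (suc (suc n)) p q ⇔ (tail (word p) ≡ init (word q))
  CKArc⇔overlap p@((xs , _) , _) q@((ys , s) , c) = mk⇔ arc⇒overlap overlap⇒arc
    where
    arc⇒overlap : CKArc d (suc (suc n)) p q → tail xs ≡ init ys
    arc⇒overlap (z , _ , _ , refl) = sym (init-∷ʳ z (tail xs))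

    overlap⇒arc : tail xs ≡ init ys → CKArc d (suc (suc n)) p q
    overlap⇒arc e = last ys , ≉-head , ≉-last , ys≡
      where
      ≉-head : last ys ≉ head (tail xs)
      ≉-head = subst (last ys ≉_) (sym (trans (cong head e) (head-init ys))) c

      ≉-last : last ys ≉ last xs
      ≉-last = subst (last ys ≉_) (trans (sym (cong last e)) (last-tail xs))
                     (≉-sym (last-init-≉-last ys s))

      ys≡ : ys ≡ tail xs ∷ʳ last ys
      ys≡ = begin
        ys                    ≡⟨ init-∷ʳ-last ys ⟨
        init ys ∷ʳ last ys    ≡⟨ cong (_∷ʳ last ys) e ⟨
        tail xs ∷ʳ last ys    ∎
        where open ≡-Reasoning

  LArc⇔overlap : ∀ p q → Arc (L (sK d (suc n))) (toArc p) (toArc q) ⇔ (tail (word p) ≡ init (word q))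
  LArc⇔overlap p q = mk⇔ (cong proj₁) Word-≡

  iso : CK d (suc (suc n)) ≅ L (sK d (suc n))
  iso = record
    { bij     = ↔⇒⤖ (mk↔ₛ′ toArc fromArc toArc-fromArc fromArc-toArc)
    ; arc-iff = λ p q → ⇔.trans (CKArc⇔overlap p q) (⇔.sym (LArc⇔overlap p q))
    }

mainTheorem1 : (d ℓ : ℕ) → 2 ≤ d → 2 ≤ ℓ → CK d ℓ ≅ L (sK d (ℓ ∸ 1))
mainTheorem1 d (suc (suc n)) _ _       = CK≅LsK.iso d n
mainTheorem1 d (suc zero)    _ (s≤s ())
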